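{- Let $M=\{2,d_1,d_2,\dots,d_k\}\subset\mathbb{N}$ be a finite set with $2<d_1<d_2<\dots<d_k$ (where $k\ge 0$). Then $M$ is uhc-realizable. If $k>0$, then $M$ is also strongly uhc-realizable.
   Context: Graphs are finite, simple and undirected. A graph is uniquely hamiltonian if it has exactly one hamiltonian cycle. For a graph $G$ with vertex set $V$, its degree set is $M_{deg}(G)=\{\deg(v)\mid v\in V\}$. For a finite set $M=\{d_0,d_1,\dots,d_k\}$ of natural numbers with $d_0<d_1<\dots<d_k$, a graph $G$ realizes $M$ if $G$ is uniquely hamiltonian, $M_{deg}(G)=M$, and $G$ is $2$-connected if $2\in M$, resp. $3$-connected if $2\notin M$. $M$ is uhc-realizable if some graph realizes $M$. For $k>0$, $M$ is strongly uhc-realizable if for each partition $D_1,D_2$ of $\{d_1,\dots,d_k\}$ (one of $D_1,D_2$ possibly empty) there are constants $c_1\in\mathbb{N}$, $c_2\in\mathbb{R}$ with $c_2>0$, and an infinite sequence of graphs $G_i=(V_i,E_i)$ realizing $M$, such that for every $d\in D_1$ each $G_i$ has at most $c_1$ vertices of degree $d$, and for every $d'\in D_2$ each $G_i$ has at least $c_2|V_i|$ vertices of degree $d'$. -}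

module Defs where

open import Data.Nat as ℕ using (ℕ; zero; suc; _<_; _≤_; _≡ᵇ_)
open import Data.Integer as ℤ using (+_)
open import Data.Rational as ℚ using (ℚ; 0ℚ)
open import Data.Bool using (Bool; true; false; if_then_else_)
open import Data.Fin using (Fin; toℕ)
open import Data.Fin.Subset as Sub using (Subset; ∣_∣)
open import Data.List using (List; []; _∷_; map; allFin)
open import Data.Nat.ListAction using (sum)
open import Data.List.Membership.Propositional as LM using ()
open import Data.List.Relation.Unary.All using (All)
open import Data.List.Relation.Unary.Linked using (Linked)
open import Data.Product using (Σ; ∃; ∃-syntax; _×_)
open import Data.Sum using (_⊎_)
open import Relation.Nullary using (¬_)
open import Relation.Binary.PropositionalEquality using (_≡_)
open import Function.Definitions using (Injective)
open import Function.Bundles using (_⇔_)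

record Graph (n : ℕ) : Set where
  field
    adj    : Fin n → Fin n → Bool
    sym    : ∀ u v → adj u v ≡ adj v u
    irrefl : ∀ v → adj v v ≡ false
open Graph public

Adj : ∀ {n} → Graph n → Fin n → Fin n → Set
Adj G u v = adj G u v ≡ true

deg : ∀ {n} → Graph n → Fin n → ℕ
deg {n} G v = sum (map (λ w → if adj G v w then 1 else 0) (allFin n))

countDeg : ∀ {n} → Graph n → ℕ → ℕ
countDeg {n} G d = sum (map (λ v → if deg G v ≡ᵇ d then 1 else 0) (allFin n))

Consec : (n : ℕ) → Fin n → Fin n → Set
Consec n i j = (suc (toℕ i) ≡ toℕ j) ⊎ (suc (toℕ i) ≡ n × toℕ j ≡ 0)

-- σ lists all vertices in the cyclic order of a hamiltonian cycle
HamOrder : ∀ {n} → Graph n → (Fin n → Fin n) → Set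
HamOrder {n} G σ = (3 ≤ n) × Injective _≡_ _≡_ σ × (∀ i j → Consec n i j → Adj G (σ i) (σ j))

CycEdge : ∀ {n} → (Fin n → Fin n) → Fin n → Fin n → Set
CycEdge {n} σ u v = ∃[ i ] ∃[ j ] (Consec n i j × ((σ i ≡ u × σ j ≡ v) ⊎ (σ i ≡ v × σ j ≡ u)))

-- exactly one hamiltonian cycle (cycles compared as edge sets)
UniquelyHamiltonian : ∀ {n} → Graph n → Set
UniquelyHamiltonian {n} G =
  Σ (Fin n → Fin n) λ σ → HamOrder G σ ×
    (∀ τ → HamOrder G τ → ∀ u v → CycEdge σ u v ⇔ CycEdge τ u v)

data WalkAvoiding {n} (G : Graph n) (S : Subset n) : Fin n → Fin n → Set where
  here  : ∀ {u} → WalkAvoiding G S u u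
  step  : ∀ {u w v} → Adj G u w → ¬ (w Sub.∈ S) → WalkAvoiding G S w v → WalkAvoiding G S u v

KConnected : ℕ → ∀ {n} → Graph n → Set
KConnected k {n} G = (k < n) × (∀ (S : Subset n) → ∣ S ∣ < k →
  ∀ u v → ¬ (u Sub.∈ S) → ¬ (v Sub.∈ S) → WalkAvoiding G S u v)

Realizes : List ℕ → ∀ {n} → Graph n → Set
Realizes M {n} G =
  UniquelyHamiltonian G ×
  (∀ d → (d LM.∈ M) ⇔ (∃[ v ] deg G v ≡ d)) ×
  ((2 LM.∈ M) → KConnected 2 G) ×
  (¬ (2 LM.∈ M) → KConnected 3 G)

UhcRealizable : List ℕ → Set
UhcRealizable M = Σ ℕ λ n → Σ (Graph n) λ G → Realizes M G

ℕtoℚ : ℕ → ℚ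
ℕtoℚ m = + m ℚ./ 1

-- M = {d0} ∪ ds, d0 < d1 < … < dk; a partition D1,D2 of ds is encoded by inD2 : ℕ → Bool.
StronglyUhcRealizable : ℕ → List ℕ → Set
StronglyUhcRealizable d0 ds =
  ∀ (inD2 : ℕ → Bool) →
    Σ ℕ λ c₁ → Σ ℚ λ c₂ → (0ℚ ℚ.< c₂) ×
    Σ (ℕ → ℕ) λ size → Σ ((i : ℕ) → Graph (size i)) λ G →
      (∀ i → size i < size (suc i)) ×
      (∀ i → Realizes (d0 ∷ ds) (G i)) ×
      (∀ i d → d LM.∈ ds → inD2 d ≡ false → countDeg (G i) d ≤ c₁) ×
      (∀ i d → d LM.∈ ds → inD2 d ≡ true → c₂ ℚ.* ℕtoℚ (size i) ℚ.≤ ℕtoℚ (countDeg (G i) d))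

-- Write each d ∈ M ∖ {2} as d = c + 2. Take a cycle and cut an initial stretch of it into
-- blocks, one of 2(c + 1) consecutive vertices for each such c, and join the c + 1 vertices at
-- even offsets of a block (its hubs) pairwise; a hub then has degree c + 2 = d and every other
-- vertex degree 2. Hubs are never cyclically consecutive, so every edge of the cycle has an
-- endpoint of degree 2. A hamiltonian cycle uses both edges at such a vertex, so it contains every
-- edge of the original cycle and is that cycle. A graph with a hamiltonian cycle is 2-connected.
-- For strong realizability, the i-th graph repeats the blocks of the degrees in D₂ i + 1 times and
-- appends 3(i + 1) vertices of degree 2: a degree in D₁ then occurs only on the first blocks, and
-- a degree in D₂ at least i + 1 times, which is a fixed fraction of the order.

module Submission where

open import Defs hiding (sym)
open import Data.Bool using (Bool; true; false; if_then_else_; _∨_; _∧_; not; T; T?)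
open import Data.Bool.Properties using (∨-comm; ∧-comm; ∧-zeroʳ; ∧-identityʳ; ∧-conicalˡ; T-≡)
open import Data.Empty using (⊥; ⊥-elim)
open import Data.Fin using (Fin; toℕ; fromℕ<; punchOut)
import Data.Fin.Properties as Fin
open import Data.Fin.Subset using (Subset; ∣_∣; ⁅_⁆; _⊂_) renaming (_∈_ to _∈ₛ_; _∉_ to _∉ₛ_)
open import Data.Fin.Subset.Properties using (x∈⁅y⁆⇒x≡y; x≢y⇒x∉⁅y⁆; ∣⁅x⁆∣≡1; p⊂q⇒∣p∣<∣q∣) renaming (_∈?_ to _∈ₛ?_)
open import Data.Integer as ℤ using (+≤+)
import Data.Integer.Properties as ℤ
open import Data.List using (List; []; _∷_; _++_; map; allFin; tabulate; concat; replicate; filterᵇ)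
open import Data.List.Membership.Propositional using (_∈_)
open import Data.List.Membership.Propositional.Properties using (∈-map⁺; ∈-map⁻; ∈-++⁺ˡ; ∈-++⁻; ∈-filter⁺; ∈-filter⁻)
open import Data.List.Properties using (map-tabulate; map-cong)
open import Data.List.Relation.Binary.Subset.Propositional using (_⊆_)
open import Data.List.Relation.Unary.All as All using (All)
open import Data.List.Relation.Unary.Any using (here; there)
open import Data.List.Relation.Unary.Linked using (Linked)
open import Data.Nat using (ℕ; zero; suc; pred; _+_; _∸_; _*_; _≤_; _<_; z≤n; s≤s; z<s; s<s; _≟_; _≤?_; _<?_)
open import Data.Nat.Coprimality using (1-coprimeTo) renaming (sym to coprime-sym)
open import Data.Nat.ListAction using (sum)
open import Data.Nat.Properties
open import Data.Nat.Tactic.RingSolver using (solve-∀)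
open import Data.Product using (∃; _×_; _,_; proj₁; proj₂)
open import Data.Rational as ℚ using (ℚ; mkℚ; 0ℚ)
import Data.Rational.Properties as ℚ
import Data.Rational.Unnormalised as ℚᵘ
import Data.Rational.Unnormalised.Properties as ℚᵘ
open import Data.Sum as ⊎ using (_⊎_; inj₁; inj₂)
open import Function using (_∘_; id)
open import Function.Bundles using (_⇔_; mk⇔; Equivalence)
open import Function.Definitions using (Injective)
open import Relation.Nullary using (¬_; Dec; yes; no; does; contradiction; _×-dec_)
open import Relation.Nullary.Decidable using (dec-true; dec-false)
open import Relation.Binary.PropositionalEquality

𝟙 : Bool → ℕ
𝟙 b = if b then 1 else 0

𝟙≤1 : ∀ b → 𝟙 b ≤ 1
𝟙≤1 true  = s≤s z≤n
𝟙≤1 false = z≤n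

𝟙-∨³ : ∀ x y z →
  (x ≡ true → y ≡ true → ⊥) → (x ≡ true → z ≡ true → ⊥) → (y ≡ true → z ≡ true → ⊥) →
  𝟙 ((x ∨ y) ∨ z) ≡ 𝟙 x + 𝟙 y + 𝟙 z
𝟙-∨³ true  true  _     xy _  _  = ⊥-elim (xy refl refl)
𝟙-∨³ true  false true  _  xz _  = ⊥-elim (xz refl refl)
𝟙-∨³ false true  true  _  _  yz = ⊥-elim (yz refl refl)
𝟙-∨³ true  false false _  _  _  = refl
𝟙-∨³ false true  false _  _  _  = refl
𝟙-∨³ false false z     _  _  _  = refl

does-true : ∀ {A : Set} (a? : Dec A) → does a? ≡ true → A
does-true (yes a) _ = a

sum< : ℕ → (ℕ → ℕ) → ℕ
sum< zero    f = 0
sum< (suc n) f = f 0 + sum< n (f ∘ suc)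

sum<-cong : ∀ n {f g : ℕ → ℕ} → (∀ {a} → a < n → f a ≡ g a) → sum< n f ≡ sum< n g
sum<-cong zero    f≡g = refl
sum<-cong (suc n) f≡g = cong₂ _+_ (f≡g z<s) (sum<-cong n (f≡g ∘ s<s))

sum<-zero : ∀ n {f : ℕ → ℕ} → (∀ {a} → a < n → f a ≡ 0) → sum< n f ≡ 0
sum<-zero n f≡0 = trans (sum<-cong n f≡0) (zeros n)
  where
  zeros : ∀ n → sum< n (λ _ → 0) ≡ 0
  zeros zero    = refl
  zeros (suc n) = zeros n

sum<-+ : ∀ n (f g : ℕ → ℕ) → sum< n (λ a → f a + g a) ≡ sum< n f + sum< n g
sum<-+ zero    f g = refl
sum<-+ (suc n) f g = begin
  f 0 + g 0 + sum< n (λ a → f (suc a) + g (suc a))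
    ≡⟨ cong (f 0 + g 0 +_) (sum<-+ n (f ∘ suc) (g ∘ suc)) ⟩
  f 0 + g 0 + (sum< n (f ∘ suc) + sum< n (g ∘ suc))
    ≡⟨ interchange (f 0) (g 0) _ _ ⟩
  f 0 + sum< n (f ∘ suc) + (g 0 + sum< n (g ∘ suc)) ∎
  where
  open ≡-Reasoning
  interchange : ∀ a b c d → a + b + (c + d) ≡ a + c + (b + d)
  interchange = solve-∀

sum<-split : ∀ m k (f : ℕ → ℕ) → sum< (m + k) f ≡ sum< m f + sum< k (λ a → f (m + a))
sum<-split zero    k f = refl
sum<-split (suc m) k f =
  trans (cong (f 0 +_) (sum<-split m k (f ∘ suc))) (sym (+-assoc (f 0) _ _))

sum<-𝟙≤ : ∀ n (p : ℕ → Bool) → sum< n (𝟙 ∘ p) ≤ n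
sum<-𝟙≤ zero    p = z≤n
sum<-𝟙≤ (suc n) p = +-mono-≤ (𝟙≤1 (p 0)) (sum<-𝟙≤ n (p ∘ suc))

term≤sum< : ∀ n (f : ℕ → ℕ) {a} → a < n → f a ≤ sum< n f
term≤sum< (suc n) f {zero}  _         = m≤m+n (f 0) _
term≤sum< (suc n) f {suc a} (s<s a<n) = ≤-trans (term≤sum< n (f ∘ suc) a<n) (m≤n+m _ (f 0))

sum<-point : ∀ n {c} → c < n → sum< n (λ a → 𝟙 (does (a ≟ c))) ≡ 1
sum<-point (suc n) {zero}  _         = cong suc (sum<-zero n (λ _ → refl))
sum<-point (suc n) {suc c} (s<s c<n) = sum<-point n c<n

sum-allFin : ∀ n {f : Fin n → ℕ} (g : ℕ → ℕ) → (∀ v → f v ≡ g (toℕ v)) →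
  sum (map f (allFin n)) ≡ sum< n g
sum-allFin n {f} g f≡g = begin
  sum (map f (allFin n))          ≡⟨ cong sum (map-cong f≡g (allFin n)) ⟩
  sum (map (g ∘ toℕ) (allFin n))  ≡⟨ cong sum (map-tabulate {n = n} id (g ∘ toℕ)) ⟩
  sum (tabulate {n = n} (g ∘ toℕ)) ≡⟨ sum-tabulate n g ⟩
  sum< n g                        ∎
  where
  open ≡-Reasoning
  sum-tabulate : ∀ n (g : ℕ → ℕ) → sum (tabulate {n = n} (g ∘ toℕ)) ≡ sum< n g
  sum-tabulate zero    g = refl
  sum-tabulate (suc n) g = cong (g 0 +_) (sum-tabulate n (g ∘ suc))

injective⇒surjective : ∀ {n} {f : Fin n → Fin n} → Injective _≡_ _≡_ f →
  ∀ y → ∃ λ x → f x ≡ y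
injective⇒surjective {zero}  _     ()
injective⇒surjective {suc m} {f} f-inj y with Fin.any? (λ x → f x Fin.≟ y)
... | yes hit = hit
... | no miss =
  let i , j , i<j , eq = Fin.pigeonhole (n<1+n m) (punchOut ∘ missed)
  in  contradiction (f-inj (Fin.punchOut-injective (missed i) (missed j) eq)) (Fin.<⇒≢ i<j)
  where
  missed : ∀ x → y ≢ f x
  missed x = miss ∘ (x ,_) ∘ sym

Pair : {A : Set} → A → A → A → Set
Pair x y w = w ≡ x ⊎ w ≡ y

Pair-⊆-reverse : {A : Set} {x y x′ y′ : A} → x ≢ y →
  (∀ {w} → Pair x y w → Pair x′ y′ w) → ∀ {w} → Pair x′ y′ w → Pair x y w
Pair-⊆-reverse {x = x} {y} x≢y ⊆ with ⊆ {x} (inj₁ refl) | ⊆ {y} (inj₂ refl)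
... | inj₁ x≡x′ | inj₁ y≡x′ = contradiction (trans x≡x′ (sym y≡x′)) x≢y
... | inj₂ x≡y′ | inj₂ y≡y′ = contradiction (trans x≡y′ (sym y≡y′)) x≢y
... | inj₁ x≡x′ | inj₂ y≡y′ = λ { (inj₁ refl) → inj₁ (sym x≡x′) ; (inj₂ refl) → inj₂ (sym y≡y′) }
... | inj₂ x≡y′ | inj₁ y≡x′ = λ { (inj₁ refl) → inj₂ (sym y≡x′) ; (inj₂ refl) → inj₁ (sym x≡y′) }

module CyclicOrder {n : ℕ} (3≤n : 3 ≤ n) where

  next : ℕ → ℕ
  next a with suc a ≟ n
  ... | yes _ = 0
  ... | no  _ = suc a

  prev : ℕ → ℕ
  prev zero    = pred n
  prev (suc a) = a

  next-suc : ∀ {a} → suc a < n → next a ≡ suc a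
  next-suc {a} 1+a<n with suc a ≟ n
  ... | yes 1+a≡n = contradiction 1+a≡n (<⇒≢ 1+a<n)
  ... | no  _     = refl

  next-last : ∀ {a} → suc a ≡ n → next a ≡ 0
  next-last {a} 1+a≡n with suc a ≟ n
  ... | yes _     = refl
  ... | no  1+a≢n = contradiction 1+a≡n 1+a≢n

  next<n : ∀ {a} → a < n → next a < n
  next<n {a} a<n with suc a ≟ n
  ... | yes _     = ≤-trans (s≤s z≤n) a<n
  ... | no  1+a≢n = ≤∧≢⇒< a<n 1+a≢n

  prev<n : ∀ {a} → a < n → prev a < n
  prev<n {zero}  z<s = n<1+n _
  prev<n {suc a} a<n = <-trans (n<1+n a) a<n

  prev-next : ∀ {a} → a < n → prev (next a) ≡ a
  prev-next {a} a<n with suc a ≟ n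
  ... | yes 1+a≡n = cong pred (sym 1+a≡n)
  ... | no  _     = refl

  next-prev : ∀ {a} → a < n → next (prev a) ≡ a
  next-prev {zero}  (s≤s {n = m} _) = next-last {m} refl
  next-prev {suc a} a<n             = next-suc a<n

  next≢self : ∀ {a} → a < n → next a ≢ a
  next≢self {a} a<n with suc a ≟ n
  next≢self {zero}  a<n | yes 1≡n = λ _ → <⇒≢ (<⇒≤ 3≤n) 1≡n
  next≢self {suc a} a<n | yes _   = λ ()
  next≢self {a}     a<n | no  _   = 1+n≢n

  next²≢self : ∀ {a} → a < n → next (next a) ≢ a
  next²≢self {a} a<n with m≤n⇒m<n∨m≡n a<n
  ... | inj₂ 1+a≡n rewrite next-last 1+a≡n | next-suc {0} (≤-trans (s≤s (s≤s z≤n)) 3≤n) =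
    λ 1≡a → <⇒≢ 3≤n (trans (cong suc 1≡a) 1+a≡n)
  ... | inj₁ 1+a<n rewrite next-suc 1+a<n with m≤n⇒m<n∨m≡n 1+a<n
  ...   | inj₁ 2+a<n rewrite next-suc 2+a<n = λ ()
  ...   | inj₂ 2+a≡n rewrite next-last 2+a≡n = λ { refl → <⇒≢ 3≤n 2+a≡n }

  next≡⇒prev≡ : ∀ {a b} → a < n → b ≡ next a → a ≡ prev b
  next≡⇒prev≡ a<n refl = sym (prev-next a<n)

  prev≡⇒next≡ : ∀ {a b} → b < n → a ≡ prev b → b ≡ next a
  prev≡⇒next≡ b<n refl = sym (next-prev b<n)

  Consec⇒next : ∀ {i j} → Consec n i j → toℕ j ≡ next (toℕ i)
  Consec⇒next {i} {j} (inj₁ 1+i≡j) =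
    sym (trans (next-suc (subst (_< n) (sym 1+i≡j) (Fin.toℕ<n j))) 1+i≡j)
  Consec⇒next (inj₂ (1+i≡n , j≡0)) = trans j≡0 (sym (next-last 1+i≡n))

  next⇒Consec : ∀ {i j} → toℕ j ≡ next (toℕ i) → Consec n i j
  next⇒Consec {i} {j} j≡next with suc (toℕ i) ≟ n
  ... | yes 1+i≡n = inj₂ (1+i≡n , j≡next)
  ... | no  _     = inj₁ (sym j≡next)

  nextF : Fin n → Fin n
  nextF i = fromℕ< (next<n (Fin.toℕ<n i))

  prevF : Fin n → Fin n
  prevF i = fromℕ< (prev<n (Fin.toℕ<n i))

  toℕ-nextF : ∀ i → toℕ (nextF i) ≡ next (toℕ i)
  toℕ-nextF i = Fin.toℕ-fromℕ< _

  toℕ-prevF : ∀ i → toℕ (prevF i) ≡ prev (toℕ i)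
  toℕ-prevF i = Fin.toℕ-fromℕ< _

  Consec-next : ∀ i → Consec n i (nextF i)
  Consec-next i = next⇒Consec (toℕ-nextF i)

  Consec⇒≡next : ∀ {i j} → Consec n i j → j ≡ nextF i
  Consec⇒≡next {i} c = Fin.toℕ-injective (trans (Consec⇒next c) (sym (toℕ-nextF i)))

  Consec⇒≡prev : ∀ {i j} → Consec n i j → i ≡ prevF j
  Consec⇒≡prev {i} {j} c = Fin.toℕ-injective
    (trans (next≡⇒prev≡ (Fin.toℕ<n i) (Consec⇒next c)) (sym (toℕ-prevF j)))

  nextF-prevF : ∀ i → nextF (prevF i) ≡ i
  nextF-prevF i = Fin.toℕ-injective (begin
    toℕ (nextF (prevF i))  ≡⟨ toℕ-nextF (prevF i) ⟩
    next (toℕ (prevF i))   ≡⟨ cong next (toℕ-prevF i) ⟩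
    next (prev (toℕ i))    ≡⟨ next-prev (Fin.toℕ<n i) ⟩
    toℕ i                  ∎)
    where open ≡-Reasoning

  Consec-prev : ∀ i → Consec n (prevF i) i
  Consec-prev i = subst (Consec n (prevF i)) (nextF-prevF i) (Consec-next (prevF i))

  prevF-nextF : ∀ i → prevF (nextF i) ≡ i
  prevF-nextF i = sym (Consec⇒≡prev (Consec-next i))

  nextF≢prevF : ∀ i → nextF i ≢ prevF i
  nextF≢prevF i next≡prev = next²≢self (Fin.toℕ<n i) (begin
    next (next (toℕ i))   ≡⟨ cong next (sym (toℕ-nextF i)) ⟩
    next (toℕ (nextF i))  ≡⟨ cong (next ∘ toℕ) next≡prev ⟩
    next (toℕ (prevF i))  ≡⟨ sym (toℕ-nextF (prevF i)) ⟩
    toℕ (nextF (prevF i)) ≡⟨ cong toℕ (nextF-prevF i) ⟩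
    toℕ i                 ∎)
    where open ≡-Reasoning

  CycEdge-sym : ∀ {σ : Fin n → Fin n} {u w} → CycEdge σ u w → CycEdge σ w u
  CycEdge-sym (i , j , c , inj₁ e) = i , j , c , inj₂ e
  CycEdge-sym (i , j , c , inj₂ e) = i , j , c , inj₁ e

  CycEdge⇔Pair : ∀ {σ : Fin n → Fin n} {k u w} → Injective _≡_ _≡_ σ → σ k ≡ u →
    CycEdge σ u w ⇔ Pair (σ (nextF k)) (σ (prevF k)) w
  CycEdge⇔Pair {σ} {k} σ-inj σk≡u = mk⇔ to from
    where
    to : ∀ {w} → CycEdge σ _ w → Pair (σ (nextF k)) (σ (prevF k)) w
    to (i , j , c , inj₁ (σi≡u , refl)) with refl ← σ-inj (trans σi≡u (sym σk≡u)) =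
      inj₁ (cong σ (Consec⇒≡next c))
    to (i , j , c , inj₂ (refl , σj≡u)) with refl ← σ-inj (trans σj≡u (sym σk≡u)) =
      inj₂ (cong σ (Consec⇒≡prev c))
    from : ∀ {w} → Pair (σ (nextF k)) (σ (prevF k)) w → CycEdge σ _ w
    from (inj₁ refl) = k , nextF k , Consec-next k , inj₁ (σk≡u , refl)
    from (inj₂ refl) = prevF k , k , Consec-prev k , inj₂ (refl , σk≡u)

∈ₛ-unique : ∀ {n} {S : Subset n} {x y} → ∣ S ∣ < 2 → x ∈ₛ S → y ∈ₛ S → x ≡ y
∈ₛ-unique {S = S} {x} {y} ∣S∣<2 x∈S y∈S with x Fin.≟ y
... | yes x≡y = x≡y
... | no  x≢y = contradiction (subst (_< ∣ S ∣) (∣⁅x⁆∣≡1 x) (p⊂q⇒∣p∣<∣q∣ ⁅x⁆⊂S)) (<⇒≱ ∣S∣<2)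
  where
  ⁅x⁆⊂S : ⁅ x ⁆ ⊂ S
  ⁅x⁆⊂S = (λ w∈⁅x⁆ → subst (_∈ₛ S) (sym (x∈⁅y⁆⇒x≡y x w∈⁅x⁆)) x∈S) ,
          y , y∈S , x≢y⇒x∉⁅y⁆ (x≢y ∘ sym)

module HamiltonianCycle {n} (G : Graph n) (3≤n : 3 ≤ n)
                        (Consec⇒Adj : ∀ i j → Consec n i j → Adj G i j) where

  open CyclicOrder 3≤n

  Adj-sym : ∀ {u w} → Adj G u w → Adj G w u
  Adj-sym {u} {w} uw = trans (Graph.sym G w u) uw

  OnlyCycleNeighbours : Fin n → Set
  OnlyCycleNeighbours u = ∀ w → Adj G u w → Pair (nextF u) (prevF u) w

  module _ (forced : ∀ i → OnlyCycleNeighbours i ⊎ OnlyCycleNeighbours (nextF i)) where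

    module _ {τ : Fin n → Fin n} (hτ : HamOrder G τ) where

      private
        τ-inj = proj₁ (proj₂ hτ)
        τ-adj = proj₂ (proj₂ hτ)

      forced-edge : ∀ {u w} → OnlyCycleNeighbours u → Pair (nextF u) (prevF u) w → CycEdge τ u w
      forced-edge {u} only uw with k , refl ← injective⇒surjective τ-inj u =
        Equivalence.from (CycEdge⇔Pair τ-inj refl) (Pair-⊆-reverse (nextF≢prevF k ∘ τ-inj) τ-nbr⇒nbr uw)
        where
        τ-nbr⇒nbr : ∀ {w} → Pair (τ (nextF k)) (τ (prevF k)) w → Pair (nextF (τ k)) (prevF (τ k)) w
        τ-nbr⇒nbr (inj₁ refl) = only _ (τ-adj k (nextF k) (Consec-next k))
        τ-nbr⇒nbr (inj₂ refl) = only _ (Adj-sym (τ-adj (prevF k) k (Consec-prev k)))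

      cycle-edge : ∀ {u w} → Pair (nextF u) (prevF u) w → CycEdge τ u w
      cycle-edge {u} (inj₁ refl) with forced u
      ... | inj₁ only-u    = forced-edge only-u (inj₁ refl)
      ... | inj₂ only-next = CycEdge-sym (forced-edge only-next (inj₂ (sym (prevF-nextF u))))
      cycle-edge {u} (inj₂ refl) with forced (prevF u)
      ... | inj₁ only-prev = CycEdge-sym (forced-edge only-prev (inj₁ (sym (nextF-prevF u))))
      ... | inj₂ only-next = forced-edge (subst OnlyCycleNeighbours (nextF-prevF u) only-next) (inj₂ refl)

      cycle-edges⇔ : ∀ u w → CycEdge id u w ⇔ CycEdge τ u w
      cycle-edges⇔ u w =
        mk⇔ (cycle-edge ∘ Equivalence.to id-edges) (Equivalence.from id-edges ∘ τ-edge⇒cycle)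
        where
        id-edges = CycEdge⇔Pair {σ = id} {k = u} {w = w} id refl
        τ-edge⇒cycle : CycEdge τ u w → Pair (nextF u) (prevF u) w
        τ-edge⇒cycle e with k , refl ← injective⇒surjective τ-inj u =
          Pair-⊆-reverse (nextF≢prevF u)
            (Equivalence.to (CycEdge⇔Pair τ-inj refl) ∘ cycle-edge)
            (Equivalence.to (CycEdge⇔Pair τ-inj refl) e)

    uniquelyHamiltonian : UniquelyHamiltonian G
    uniquelyHamiltonian = id , (3≤n , id , Consec⇒Adj) , λ _ hτ → cycle-edges⇔ hτ

  module Walks (S : Subset n) where

    Walk : Fin n → Fin n → Set
    Walk = WalkAvoiding G S

    _++ʷ_ : ∀ {u v w} → Walk u v → Walk v w → Walk u w
    here         ++ʷ r′ = r′
    step a x∉S r ++ʷ r′ = step a x∉S (r ++ʷ r′)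

    reverse : ∀ {u v} → u ∉ₛ S → Walk u v → Walk v u
    reverse u∉S here            = here
    reverse u∉S (step uw w∉S r) = reverse w∉S r ++ʷ step (Adj-sym uw) u∉S here

    walk-up : ∀ {u v} → toℕ u ≤ toℕ v →
      (∀ w → toℕ u < toℕ w → toℕ w ≤ toℕ v → w ∉ₛ S) → Walk u v
    walk-up {u} {v} u≤v = go (toℕ v ∸ toℕ u) (m∸n+n≡m u≤v)
      where
      go : ∀ k {u} → k + toℕ u ≡ toℕ v →
        (∀ w → toℕ u < toℕ w → toℕ w ≤ toℕ v → w ∉ₛ S) → Walk u v
      go zero    u≡v clear = subst (λ x → Walk x v) (Fin.toℕ-injective (sym u≡v)) here
      go (suc k) {u} k+u≡v clear =
        step (Consec⇒Adj u (nextF u) (Consec-next u)) (clear _ u<u′ u′≤v)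
             (go k k+u′≡v (λ w u′<w → clear w (<-trans u<u′ u′<w)))
        where
        1+u≤v : suc (toℕ u) ≤ toℕ v
        1+u≤v = subst (suc (toℕ u) ≤_) k+u≡v (s≤s (m≤n+m (toℕ u) k))
        u′≡1+u : toℕ (nextF u) ≡ suc (toℕ u)
        u′≡1+u = trans (toℕ-nextF u) (next-suc (≤-<-trans 1+u≤v (Fin.toℕ<n v)))
        u<u′ : toℕ u < toℕ (nextF u)
        u<u′ = ≤-reflexive (sym u′≡1+u)
        u′≤v : toℕ (nextF u) ≤ toℕ v
        u′≤v = subst (_≤ toℕ v) (sym u′≡1+u) 1+u≤v
        k+u′≡v : k + toℕ (nextF u) ≡ toℕ v
        k+u′≡v = trans (cong (k +_) u′≡1+u) (trans (+-suc k (toℕ u)) k+u≡v)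

    origin : Fin n
    origin = fromℕ< (≤-trans (s≤s z≤n) 3≤n)

    toℕ-origin : toℕ origin ≡ 0
    toℕ-origin = Fin.toℕ-fromℕ< (≤-trans (s≤s z≤n) 3≤n)

    -- u, u − 1, …, 0, n − 1, n − 2, …, v
    walk-around : ∀ {u v} → toℕ u ≤ toℕ v →
      (∀ w → toℕ w ≤ toℕ u ⊎ toℕ v ≤ toℕ w → w ∉ₛ S) → Walk u v
    walk-around {u} {v} u≤v clear =
      reverse (clear origin (inj₁ 0≤u)) (walk-up 0≤u (λ w _ w≤u → clear w (inj₁ w≤u)))
      ++ʷ step (Adj-sym (Consec⇒Adj (prevF origin) origin (Consec-prev origin))) (clear _ (inj₂ v≤last))
               (reverse (clear v (inj₂ ≤-refl)) (walk-up v≤last (λ w v<w _ → clear w (inj₂ (<⇒≤ v<w)))))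
      where
      0≤u : toℕ origin ≤ toℕ u
      0≤u = subst (_≤ toℕ u) (sym toℕ-origin) z≤n
      v≤last : toℕ v ≤ toℕ (prevF origin)
      v≤last = subst (toℕ v ≤_) (sym (trans (toℕ-prevF origin) (cong prev toℕ-origin)))
                     (suc[m]≤n⇒m≤pred[n] (Fin.toℕ<n v))

    connect-ordered : ∣ S ∣ < 2 → ∀ {u v} → toℕ u ≤ toℕ v → v ∉ₛ S → Walk u v
    connect-ordered ∣S∣<2 {u} {v} u≤v v∉S
      with Fin.any? (λ w → (toℕ u <? toℕ w) ×-dec (toℕ w ≤? toℕ v) ×-dec (w ∈ₛ? S))
    ... | no  unblocked = walk-up u≤v (λ w u<w w≤v w∈S → unblocked (w , u<w , w≤v , w∈S))
    ... | yes (s , u<s , s≤v , s∈S) = walk-around u≤v outside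
      where
      outside : ∀ w → toℕ w ≤ toℕ u ⊎ toℕ v ≤ toℕ w → w ∉ₛ S
      outside w side w∈S with refl ← ∈ₛ-unique ∣S∣<2 w∈S s∈S with side
      ... | inj₁ w≤u = <⇒≱ u<s w≤u
      ... | inj₂ v≤w = v∉S (subst (_∈ₛ S) (Fin.toℕ-injective (≤-antisym s≤v v≤w)) s∈S)

  2-connected : KConnected 2 G
  2-connected = 3≤n , connect
    where
    connect : ∀ S → ∣ S ∣ < 2 → ∀ u v → u ∉ₛ S → v ∉ₛ S → WalkAvoiding G S u v
    connect S ∣S∣<2 u v u∉S v∉S with toℕ u ≤? toℕ v
    ... | yes u≤v = connect-ordered ∣S∣<2 u≤v v∉S
      where open Walks S
    ... | no  u≰v = reverse v∉S (connect-ordered ∣S∣<2 (<⇒≤ (≰⇒> u≰v)) u∉S)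
      where open Walks S

even : ℕ → Bool
even zero          = true
even (suc zero)    = false
even (suc (suc a)) = even a

even-suc : ∀ a → even (suc a) ≡ not (even a)
even-suc zero          = refl
even-suc (suc zero)    = refl
even-suc (suc (suc a)) = even-suc a

module ChordedCycle (n : ℕ) (3≤n : 3 ≤ n) (chord : ℕ → ℕ → Bool)
                    (chord-sym : ∀ a b → chord a b ≡ chord b a)
                    (chord-irrefl : ∀ a → chord a a ≡ false)
                    (chord-hub : ∀ {a b} → chord a b ≡ true → even a ≡ true × suc a < n) where

  open CyclicOrder 3≤n

  adjacent : ℕ → ℕ → Bool
  adjacent a b = (does (b ≟ next a) ∨ does (a ≟ next b)) ∨ chord a b

  graph : Graph n
  graph = record
    { adj    = λ u w → adjacent (toℕ u) (toℕ w)
    ; sym    = λ u w → cong₂ _∨_ (∨-comm (does (toℕ w ≟ next (toℕ u))) _)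
                                 (chord-sym (toℕ u) (toℕ w))
    ; irrefl = λ v → irreflexive (Fin.toℕ<n v)
    }
    where
    irreflexive : ∀ {a} → a < n → adjacent a a ≡ false
    irreflexive {a} a<n
      rewrite dec-false (a ≟ next a) (next≢self a<n ∘ sym) | chord-irrefl a = refl

  Consec⇒Adj : ∀ i j → Consec n i j → Adj graph i j
  Consec⇒Adj i j c rewrite dec-true (toℕ j ≟ next (toℕ i)) (Consec⇒next c) = refl

  open HamiltonianCycle graph 3≤n Consec⇒Adj public using (OnlyCycleNeighbours; 2-connected)

  Chordless : ℕ → Set
  Chordless a = ∀ b → chord a b ≡ false

  chordless : ∀ {a} → ¬ (even a ≡ true × suc a < n) → Chordless a
  chordless {a} ¬hub b with chord a b in ab
  ... | true  = contradiction (chord-hub ab) ¬hub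
  ... | false = refl

  adjacent⇒ : ∀ {a b} → adjacent a b ≡ true →
    (b ≡ next a ⊎ a ≡ next b) ⊎ chord a b ≡ true
  adjacent⇒ {a} {b} ab with b ≟ next a | a ≟ next b
  ... | yes b≡next | _          = inj₁ (inj₁ b≡next)
  ... | no  _      | yes a≡next = inj₁ (inj₂ a≡next)
  ... | no  b≢next | no  a≢next
    rewrite dec-false (b ≟ next a) b≢next | dec-false (a ≟ next b) a≢next = inj₂ ab

  chordless⇒only-cycle : ∀ {u} → Chordless (toℕ u) → OnlyCycleNeighbours u
  chordless⇒only-cycle {u} none w uw with adjacent⇒ uw
  ... | inj₁ (inj₁ w≡next) = inj₁ (Fin.toℕ-injective (trans w≡next (sym (toℕ-nextF u))))
  ... | inj₁ (inj₂ u≡next) =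
    inj₂ (Fin.toℕ-injective (trans (next≡⇒prev≡ (Fin.toℕ<n w) u≡next) (sym (toℕ-prevF u))))
  ... | inj₂ chord-uw      = contradiction (trans (sym (none (toℕ w))) chord-uw) λ ()

  -- Hubs are even and never last, so of two cyclically consecutive vertices one is chordless.
  chordless-or-next : ∀ i → Chordless (toℕ i) ⊎ Chordless (toℕ (nextF i))
  chordless-or-next i with even (toℕ i) in even-i | suc (toℕ i) <? n
  ... | false | _         = inj₁ (chordless λ (even-i′ , _) → contradiction (trans (sym even-i) even-i′) λ ())
  ... | true  | no  1+i≮n = inj₁ (chordless λ (_ , 1+i<n) → 1+i≮n 1+i<n)
  ... | true  | yes 1+i<n = inj₂ (chordless λ (even-i′ , _) → contradiction (trans (sym even-i′) odd) λ ())
    where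
    odd : even (toℕ (nextF i)) ≡ false
    odd = begin
      even (toℕ (nextF i)) ≡⟨ cong even (trans (toℕ-nextF i) (next-suc 1+i<n)) ⟩
      even (suc (toℕ i))   ≡⟨ even-suc (toℕ i) ⟩
      not (even (toℕ i))   ≡⟨ cong not even-i ⟩
      false                ∎
      where open ≡-Reasoning

  uniquelyHamiltonian : UniquelyHamiltonian graph
  uniquelyHamiltonian = HamiltonianCycle.uniquelyHamiltonian graph 3≤n Consec⇒Adj
    (⊎.map chordless⇒only-cycle chordless⇒only-cycle ∘ chordless-or-next)

  chord-not-next : ∀ {a b} → chord a b ≡ true → b ≢ next a
  chord-not-next {a} {b} ab refl with chord-hub ab | chord-hub (trans (chord-sym b a) ab)
  ... | even-a , 1+a<n | even-b , _ = contradiction (begin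
    true               ≡⟨ sym even-b ⟩
    even (next a)      ≡⟨ cong even (next-suc 1+a<n) ⟩
    even (suc a)       ≡⟨ even-suc a ⟩
    not (even a)       ≡⟨ cong not even-a ⟩
    false              ∎) λ ()
    where open ≡-Reasoning

  does-next≡does-prev : ∀ {a b} → a < n → b < n → does (a ≟ next b) ≡ does (b ≟ prev a)
  does-next≡does-prev {a} {b} a<n b<n with b ≟ prev a
  ... | yes b≡prev
    rewrite dec-true (b ≟ prev a) b≡prev | dec-true (a ≟ next b) (prev≡⇒next≡ a<n b≡prev) = refl
  ... | no  b≢prev
    rewrite dec-false (b ≟ prev a) b≢prev | dec-false (a ≟ next b) (b≢prev ∘ next≡⇒prev≡ b<n) = refl

  𝟙-adjacent : ∀ {a b} → a < n → b < n →
    𝟙 (adjacent a b) ≡ 𝟙 (does (b ≟ next a)) + 𝟙 (does (b ≟ prev a)) + 𝟙 (chord a b)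
  𝟙-adjacent {a} {b} a<n b<n rewrite does-next≡does-prev a<n b<n =
    𝟙-∨³ _ _ _ next-prev-disjoint
      (λ b≡next ab → chord-not-next ab (does-true (b ≟ next a) b≡next))
      (λ b≡prev ab → chord-not-next (trans (chord-sym b a) ab)
                                     (prev≡⇒next≡ a<n (does-true (b ≟ prev a) b≡prev)))
    where
    next-prev-disjoint : does (b ≟ next a) ≡ true → does (b ≟ prev a) ≡ true → ⊥
    next-prev-disjoint b≡next b≡prev = next²≢self a<n (begin
      next (next a) ≡⟨ cong next (sym (does-true (b ≟ next a) b≡next)) ⟩
      next b        ≡⟨ cong next (does-true (b ≟ prev a) b≡prev) ⟩
      next (prev a) ≡⟨ next-prev a<n ⟩
      a             ∎)
      where open ≡-Reasoning

  chordCount : ℕ → ℕ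
  chordCount a = sum< n (𝟙 ∘ chord a)

  degree : ∀ v → deg graph v ≡ 2 + chordCount (toℕ v)
  degree v = begin
    deg graph v
      ≡⟨ sum-allFin n (𝟙 ∘ adjacent a) (λ _ → refl) ⟩
    sum< n (𝟙 ∘ adjacent a)
      ≡⟨ sum<-cong n (𝟙-adjacent a<n) ⟩
    sum< n (λ b → 𝟙 (does (b ≟ next a)) + 𝟙 (does (b ≟ prev a)) + 𝟙 (chord a b))
      ≡⟨ sum<-+ n _ _ ⟩
    sum< n (λ b → 𝟙 (does (b ≟ next a)) + 𝟙 (does (b ≟ prev a))) + chordCount a
      ≡⟨ cong (_+ chordCount a) (sum<-+ n _ _) ⟩
    sum< n (λ b → 𝟙 (does (b ≟ next a))) + sum< n (λ b → 𝟙 (does (b ≟ prev a))) + chordCount a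
      ≡⟨ cong₂ (λ x y → x + y + chordCount a) (sum<-point n (next<n a<n)) (sum<-point n (prev<n a<n)) ⟩
    2 + chordCount a
      ∎
    where
    open ≡-Reasoning
    a = toℕ v
    a<n = Fin.toℕ<n v

data Position (L : ℕ) : ℕ → Set where
  inside : ∀ {a} → a < L → Position L a
  past   : ∀ a → Position L (L + a)

position : ∀ L a → Position L a
position L a with a <? L
... | yes a<L = inside a<L
... | no  a≮L = subst (Position L) (m+[n∸m]≡n (≮⇒≥ a≮L)) (past (a ∸ L))

double : ℕ → ℕ
double zero    = zero
double (suc c) = suc (suc (double c))

even-double+ : ∀ c a → even (double c + a) ≡ even a
even-double+ zero    a = refl
even-double+ (suc c) a = even-double+ c a

sum<-even : ∀ k → sum< (double k) (𝟙 ∘ even) ≡ k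
sum<-even zero    = refl
sum<-even (suc k) = cong suc (sum<-even k)

-- A block with parameter c consists of 2(c + 1) consecutive cycle vertices; its c + 1 vertices
-- at even offsets (the hubs) are joined pairwise, so each hub gets c chords.
blockLength : ℕ → ℕ
blockLength c = double (suc c)

width : List ℕ → ℕ
width []       = 0
width (c ∷ cs) = blockLength c + width cs

hubChord : List ℕ → ℕ → ℕ → Bool
hubChord []       a b = false
hubChord (c ∷ cs) a b with a <? blockLength c | b <? blockLength c
... | yes _ | yes _ = (even a ∧ even b) ∧ not (does (a ≟ b))
... | no  _ | no  _ = hubChord cs (a ∸ blockLength c) (b ∸ blockLength c)
... | yes _ | no  _ = false
... | no  _ | yes _ = false

hubDegree : List ℕ → ℕ → ℕ
hubDegree []       a = 0
hubDegree (c ∷ cs) a with a <? blockLength c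
... | yes _ = if even a then c else 0
... | no  _ = hubDegree cs (a ∸ blockLength c)

module _ (c : ℕ) (cs : List ℕ) where

  private
    L = blockLength c

  hubChord-inside : ∀ {a b} → a < L → b < L →
    hubChord (c ∷ cs) a b ≡ (even a ∧ even b) ∧ not (does (a ≟ b))
  hubChord-inside {a} {b} a<L b<L with a <? L | b <? L
  ... | yes _   | yes _   = refl
  ... | no  a≮L | _       = contradiction a<L a≮L
  ... | yes _   | no  b≮L = contradiction b<L b≮L

  hubChord-inside-past : ∀ {a} b → a < L → hubChord (c ∷ cs) a (L + b) ≡ false
  hubChord-inside-past {a} b a<L with a <? L | L + b <? L
  ... | yes _   | no  _  = refl
  ... | no  a≮L | _      = contradiction a<L a≮L
  ... | yes _   | yes b< = contradiction b< (m+n≮m L b)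

  hubChord-past-inside : ∀ a {b} → b < L → hubChord (c ∷ cs) (L + a) b ≡ false
  hubChord-past-inside a {b} b<L with L + a <? L | b <? L
  ... | no  _  | yes _   = refl
  ... | yes a< | _       = contradiction a< (m+n≮m L a)
  ... | no  _  | no  b≮L = contradiction b<L b≮L

  hubChord-past : ∀ a b → hubChord (c ∷ cs) (L + a) (L + b) ≡ hubChord cs a b
  hubChord-past a b with L + a <? L | L + b <? L
  ... | no  _  | no  _  = cong₂ (hubChord cs) (m+n∸m≡n L a) (m+n∸m≡n L b)
  ... | yes a< | _      = contradiction a< (m+n≮m L a)
  ... | no  _  | yes b< = contradiction b< (m+n≮m L b)

  hubDegree-inside : ∀ {a} → a < L → hubDegree (c ∷ cs) a ≡ (if even a then c else 0)
  hubDegree-inside {a} a<L with a <? L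
  ... | yes _   = refl
  ... | no  a≮L = contradiction a<L a≮L

  hubDegree-past : ∀ a → hubDegree (c ∷ cs) (L + a) ≡ hubDegree cs a
  hubDegree-past a with L + a <? L
  ... | no  _  = cong (hubDegree cs) (m+n∸m≡n L a)
  ... | yes a< = contradiction a< (m+n≮m L a)

does-≟-sym : ∀ a b → does (a ≟ b) ≡ does (b ≟ a)
does-≟-sym a b with a ≟ b
... | yes a≡b rewrite dec-true (a ≟ b) a≡b | dec-true (b ≟ a) (sym a≡b) = refl
... | no  a≢b rewrite dec-false (a ≟ b) a≢b | dec-false (b ≟ a) (a≢b ∘ sym) = refl

hubChord-sym : ∀ cs a b → hubChord cs a b ≡ hubChord cs b a
hubChord-sym []       a b = refl
hubChord-sym (c ∷ cs) a b with position (blockLength c) a | position (blockLength c) b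
... | inside a<L | inside b<L
  rewrite hubChord-inside c cs a<L b<L | hubChord-inside c cs b<L a<L =
  cong₂ _∧_ (∧-comm (even a) (even b)) (cong not (does-≟-sym a b))
... | inside a<L | past b = trans (hubChord-inside-past c cs b a<L) (sym (hubChord-past-inside c cs b a<L))
... | past a | inside b<L = trans (hubChord-past-inside c cs a b<L) (sym (hubChord-inside-past c cs a b<L))
... | past a | past b =
  trans (hubChord-past c cs a b) (trans (hubChord-sym cs a b) (sym (hubChord-past c cs b a)))

hubChord-irrefl : ∀ cs a → hubChord cs a a ≡ false
hubChord-irrefl []       a = refl
hubChord-irrefl (c ∷ cs) a with position (blockLength c) a
... | inside a<L rewrite hubChord-inside c cs a<L a<L | dec-true (a ≟ a) refl = ∧-zeroʳ _
... | past a = trans (hubChord-past c cs a a) (hubChord-irrefl cs a)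

hubChord-hub : ∀ cs {a b} → hubChord cs a b ≡ true → even a ≡ true × a < width cs
hubChord-hub (c ∷ cs) {a} {b} ab with position (blockLength c) a | position (blockLength c) b
... | inside a<L | inside b<L =
  ∧-conicalˡ _ _ (∧-conicalˡ _ _ (trans (sym (hubChord-inside c cs a<L b<L)) ab)) ,
  <-≤-trans a<L (m≤m+n (blockLength c) (width cs))
... | inside a<L | past b     = contradiction (trans (sym (hubChord-inside-past c cs b a<L)) ab) λ ()
... | past a     | inside b<L = contradiction (trans (sym (hubChord-past-inside c cs a b<L)) ab) λ ()
... | past a     | past b     with hubChord-hub cs (trans (sym (hubChord-past c cs a b)) ab)
...   | even-a , a<w = trans (even-double+ (suc c) a) even-a , +-monoʳ-< (blockLength c) a<w

sum<-block : ∀ c {a} → a < blockLength c →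
  sum< (blockLength c) (λ b → 𝟙 ((even a ∧ even b) ∧ not (does (a ≟ b)))) ≡ (if even a then c else 0)
sum<-block c {a} a<L with even a in even-a
... | false = sum<-zero (blockLength c) (λ _ → refl)
... | true  = sym (suc-injective (begin
  suc c                                           ≡⟨ sym (sum<-even (suc c)) ⟩
  sum< L (𝟙 ∘ even)                               ≡⟨ sum<-cong L {g = split} (λ {b} _ → 𝟙-even-split {b}) ⟩
  sum< L split                                    ≡⟨ sum<-+ L (𝟙 ∘ others) (𝟙 ∘ is-a) ⟩
  sum< L (𝟙 ∘ others) + sum< L (𝟙 ∘ is-a)         ≡⟨ cong (sum< L (𝟙 ∘ others) +_) (sum<-point L a<L) ⟩
  sum< L (𝟙 ∘ others) + 1                         ≡⟨ +-comm _ 1 ⟩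
  suc (sum< L (𝟙 ∘ others))                       ∎))
  where
  open ≡-Reasoning
  L = blockLength c
  others is-a : ℕ → Bool
  others b = even b ∧ not (does (a ≟ b))
  is-a   b = does (b ≟ a)
  split : ℕ → ℕ
  split b = 𝟙 (others b) + 𝟙 (is-a b)
  𝟙-even-split : ∀ {b} → 𝟙 (even b) ≡ split b
  𝟙-even-split {b} with b ≟ a
  ... | yes refl rewrite dec-true (a ≟ a) refl | even-a = refl
  ... | no  b≢a rewrite dec-false (a ≟ b) (b≢a ∘ sym) | dec-false (b ≟ a) b≢a
    = sym (trans (+-identityʳ _) (cong 𝟙 (∧-identityʳ (even b))))

sum<-width-∷ : ∀ c cs m (f : ℕ → ℕ) →
  sum< (width (c ∷ cs) + m) f ≡ sum< (blockLength c) f + sum< (width cs + m) (λ b → f (blockLength c + b))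
sum<-width-∷ c cs m f =
  trans (cong (λ k → sum< k f) (+-assoc (blockLength c) (width cs) m))
        (sum<-split (blockLength c) (width cs + m) f)

sum<-hubChord : ∀ cs a m → sum< (width cs + m) (𝟙 ∘ hubChord cs a) ≡ hubDegree cs a
sum<-hubChord []       a m = sum<-zero m (λ _ → refl)
sum<-hubChord (c ∷ cs) a m with position (blockLength c) a
... | inside a<L = begin
  sum< (width (c ∷ cs) + m) (𝟙 ∘ hubChord (c ∷ cs) a)
    ≡⟨ sum<-width-∷ c cs m (𝟙 ∘ hubChord (c ∷ cs) a) ⟩
  sum< L (𝟙 ∘ hubChord (c ∷ cs) a) + sum< (width cs + m) (λ b → 𝟙 (hubChord (c ∷ cs) a (L + b)))
    ≡⟨ cong₂ _+_ (sum<-cong L (cong 𝟙 ∘ hubChord-inside c cs a<L))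
                 (sum<-zero (width cs + m) (λ {b} _ → cong 𝟙 (hubChord-inside-past c cs b a<L))) ⟩
  sum< L (λ b → 𝟙 ((even a ∧ even b) ∧ not (does (a ≟ b)))) + 0
    ≡⟨ +-identityʳ _ ⟩
  sum< L (λ b → 𝟙 ((even a ∧ even b) ∧ not (does (a ≟ b))))
    ≡⟨ sum<-block c a<L ⟩
  (if even a then c else 0)
    ≡⟨ sym (hubDegree-inside c cs a<L) ⟩
  hubDegree (c ∷ cs) a
    ∎
  where
  open ≡-Reasoning
  L = blockLength c
... | past a = begin
  sum< (width (c ∷ cs) + m) (𝟙 ∘ hubChord (c ∷ cs) (L + a))
    ≡⟨ sum<-width-∷ c cs m (𝟙 ∘ hubChord (c ∷ cs) (L + a)) ⟩
  sum< L (𝟙 ∘ hubChord (c ∷ cs) (L + a)) +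
  sum< (width cs + m) (λ b → 𝟙 (hubChord (c ∷ cs) (L + a) (L + b)))
    ≡⟨ cong₂ _+_ (sum<-zero L (cong 𝟙 ∘ hubChord-past-inside c cs a))
                 (sum<-cong (width cs + m) (λ {b} _ → cong 𝟙 (hubChord-past c cs a b))) ⟩
  sum< (width cs + m) (𝟙 ∘ hubChord cs a)
    ≡⟨ sum<-hubChord cs a m ⟩
  hubDegree cs a
    ≡⟨ sym (hubDegree-past c cs a) ⟩
  hubDegree (c ∷ cs) (L + a)
    ∎
  where
  open ≡-Reasoning
  L = blockLength c

width-++ : ∀ xs ys → width (xs ++ ys) ≡ width xs + width ys
width-++ []       ys = refl
width-++ (x ∷ xs) ys = trans (cong (blockLength x +_) (width-++ xs ys)) (sym (+-assoc (blockLength x) _ _))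

hubDegree-beyond : ∀ cs {a} → width cs ≤ a → hubDegree cs a ≡ 0
hubDegree-beyond []       _ = refl
hubDegree-beyond (c ∷ cs) {a} w≤a with position (blockLength c) a
... | inside a<L = contradiction (<-≤-trans a<L (m≤m+n _ (width cs))) (≤⇒≯ w≤a)
... | past a     = trans (hubDegree-past c cs a) (hubDegree-beyond cs (+-cancelˡ-≤ (blockLength c) _ _ w≤a))

hubDegree-values : ∀ cs a → hubDegree cs a ≡ 0 ⊎ hubDegree cs a ∈ cs
hubDegree-values []       a = inj₁ refl
hubDegree-values (c ∷ cs) a with position (blockLength c) a
... | inside a<L with even a | hubDegree-inside c cs a<L
...   | true  | hub = inj₂ (subst (_∈ c ∷ cs) (sym hub) (here refl))
...   | false | hub = inj₁ hub
hubDegree-values (c ∷ cs) _ | past a with hubDegree-values cs a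
...   | inj₁ none = inj₁ (trans (hubDegree-past c cs a) none)
...   | inj₂ ∈cs  = inj₂ (subst (_∈ c ∷ cs) (sym (hubDegree-past c cs a)) (there ∈cs))

hubDegree-attained : ∀ cs {c} → c ∈ cs → ∃ λ a → a < width cs × hubDegree cs a ≡ c
hubDegree-attained (c ∷ cs) (here refl) =
  0 , s≤s z≤n , hubDegree-inside c cs (s≤s z≤n)
hubDegree-attained (c′ ∷ cs) (there c∈cs) with hubDegree-attained cs c∈cs
... | a , a<w , hub = blockLength c′ + a , +-monoʳ-< (blockLength c′) a<w , trans (hubDegree-past c′ cs a) hub

hubDegree-++ˡ : ∀ xs ys {a} → a < width xs → hubDegree (xs ++ ys) a ≡ hubDegree xs a
hubDegree-++ˡ (x ∷ xs) ys {a} a<w with position (blockLength x) a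
... | inside a<L = trans (hubDegree-inside x (xs ++ ys) a<L) (sym (hubDegree-inside x xs a<L))
... | past a     = begin
  hubDegree (x ∷ xs ++ ys) (blockLength x + a) ≡⟨ hubDegree-past x (xs ++ ys) a ⟩
  hubDegree (xs ++ ys) a                       ≡⟨ hubDegree-++ˡ xs ys (+-cancelˡ-< (blockLength x) _ _ a<w) ⟩
  hubDegree xs a                               ≡⟨ sym (hubDegree-past x xs a) ⟩
  hubDegree (x ∷ xs) (blockLength x + a)       ∎
  where open ≡-Reasoning

hubDegree-++ʳ : ∀ xs ys a → hubDegree (xs ++ ys) (width xs + a) ≡ hubDegree ys a
hubDegree-++ʳ []       ys a = refl
hubDegree-++ʳ (x ∷ xs) ys a = begin
  hubDegree (x ∷ xs ++ ys) (blockLength x + width xs + a)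
    ≡⟨ cong (hubDegree (x ∷ xs ++ ys)) (+-assoc (blockLength x) _ a) ⟩
  hubDegree (x ∷ xs ++ ys) (blockLength x + (width xs + a))
    ≡⟨ hubDegree-past x (xs ++ ys) (width xs + a) ⟩
  hubDegree (xs ++ ys) (width xs + a)
    ≡⟨ hubDegree-++ʳ xs ys a ⟩
  hubDegree ys a
    ∎
  where open ≡-Reasoning

degreeCount : List ℕ → ℕ → ℕ
degreeCount cs d = sum< (width cs) (λ a → 𝟙 (does (2 + hubDegree cs a ≟ d)))

degreeCount-++ : ∀ xs ys d → degreeCount (xs ++ ys) d ≡ degreeCount xs d + degreeCount ys d
degreeCount-++ xs ys d = begin
  sum< (width (xs ++ ys)) (count (xs ++ ys))
    ≡⟨ cong (λ k → sum< k (count (xs ++ ys))) (width-++ xs ys) ⟩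
  sum< (width xs + width ys) (count (xs ++ ys))
    ≡⟨ sum<-split (width xs) (width ys) (count (xs ++ ys)) ⟩
  sum< (width xs) (count (xs ++ ys)) + sum< (width ys) (count (xs ++ ys) ∘ (width xs +_))
    ≡⟨ cong₂ _+_ (sum<-cong (width xs) (λ a<w → cong indicator (hubDegree-++ˡ xs ys a<w)))
                 (sum<-cong (width ys) (λ {a} _ → cong indicator (hubDegree-++ʳ xs ys a))) ⟩
  degreeCount xs d + degreeCount ys d
    ∎
  where
  open ≡-Reasoning
  indicator : ℕ → ℕ
  indicator k = 𝟙 (does (2 + k ≟ d))
  count : List ℕ → ℕ → ℕ
  count cs = indicator ∘ hubDegree cs

degreeCount≤width : ∀ cs d → degreeCount cs d ≤ width cs
degreeCount≤width cs d = sum<-𝟙≤ (width cs) (λ a → does (2 + hubDegree cs a ≟ d))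

degreeCount-absent : ∀ cs {d} → d ≢ 2 → (∀ {c} → c ∈ cs → 2 + c ≢ d) → degreeCount cs d ≡ 0
degreeCount-absent cs {d} d≢2 absent = sum<-zero (width cs) (λ {a} _ → not-d a)
  where
  not-d : ∀ a → 𝟙 (does (2 + hubDegree cs a ≟ d)) ≡ 0
  not-d a with hubDegree-values cs a
  ... | inj₁ none rewrite none = cong 𝟙 (dec-false (2 ≟ d) (d≢2 ∘ sym))
  ... | inj₂ ∈cs = cong 𝟙 (dec-false (2 + hubDegree cs a ≟ d) (absent ∈cs))

degreeCount-present : ∀ cs {c} → c ∈ cs → 1 ≤ degreeCount cs (2 + c)
degreeCount-present cs {c} c∈cs with a , a<w , hub ← hubDegree-attained cs c∈cs =
  ≤-trans (≤-reflexive (cong 𝟙 (sym (dec-true (2 + hubDegree cs a ≟ 2 + c) (cong (2 +_) hub)))))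
          (term≤sum< (width cs) (λ a → 𝟙 (does (2 + hubDegree cs a ≟ 2 + c))) a<w)

module BlockGraph (cs : List ℕ) (p : ℕ) (3≤p : 3 ≤ p) where

  n : ℕ
  n = width cs + p

  w<n : width cs < n
  w<n = m<m+n (width cs) (≤-trans (s≤s z≤n) 3≤p)

  hub-not-last : ∀ {a b} → hubChord cs a b ≡ true → even a ≡ true × suc a < n
  hub-not-last ab with hubChord-hub cs ab
  ... | even-a , a<w = even-a , <-≤-trans (s≤s a<w) w<n

  3≤n : 3 ≤ n
  3≤n = ≤-trans 3≤p (m≤n+m p (width cs))

  module Chorded = ChordedCycle n 3≤n (hubChord cs) (hubChord-sym cs) (hubChord-irrefl cs) hub-not-last
  open Chorded public using (graph; uniquelyHamiltonian; 2-connected)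

  degree : ∀ v → deg graph v ≡ 2 + hubDegree cs (toℕ v)
  degree v = trans (Chorded.degree v) (cong (2 +_) (sum<-hubChord cs (toℕ v) p))

  degree-2 : ∃ λ v → deg graph v ≡ 2
  degree-2 = fromℕ< w<n ,
    trans (degree _) (cong (2 +_) (hubDegree-beyond cs (≤-reflexive (sym (Fin.toℕ-fromℕ< w<n)))))

  degree-hub : ∀ {c} → c ∈ cs → ∃ λ v → deg graph v ≡ 2 + c
  degree-hub c∈cs with a , a<w , hub ← hubDegree-attained cs c∈cs = v , (begin
    deg graph v                 ≡⟨ degree v ⟩
    2 + hubDegree cs (toℕ v)    ≡⟨ cong (λ a → 2 + hubDegree cs a) (Fin.toℕ-fromℕ< a<n) ⟩
    2 + hubDegree cs a          ≡⟨ cong (2 +_) hub ⟩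
    2 + _                       ∎)
    where
    open ≡-Reasoning
    a<n = <-trans a<w w<n
    v = fromℕ< a<n

  degree-values : ∀ v → deg graph v ≡ 2 ⊎ ∃ λ c → c ∈ cs × deg graph v ≡ 2 + c
  degree-values v with hubDegree-values cs (toℕ v)
  ... | inj₁ none = inj₁ (trans (degree v) (cong (2 +_) none))
  ... | inj₂ ∈cs  = inj₂ (_ , ∈cs , degree v)

  countDeg-graph : ∀ {d} → d ≢ 2 → countDeg graph d ≡ degreeCount cs d
  countDeg-graph {d} d≢2 = begin
    countDeg graph d
      ≡⟨ sum-allFin n (λ a → 𝟙 (does (2 + hubDegree cs a ≟ d)))
                      (λ v → cong (λ k → 𝟙 (does (k ≟ d))) (degree v)) ⟩
    sum< (width cs + p) (λ a → 𝟙 (does (2 + hubDegree cs a ≟ d)))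
      ≡⟨ sum<-split (width cs) p _ ⟩
    degreeCount cs d + sum< p (λ a → 𝟙 (does (2 + hubDegree cs (width cs + a) ≟ d)))
      ≡⟨ cong (degreeCount cs d +_) (sum<-zero p λ {a} _ → no-hub a) ⟩
    degreeCount cs d + 0
      ≡⟨ +-identityʳ _ ⟩
    degreeCount cs d
      ∎
    where
    open ≡-Reasoning
    no-hub : ∀ a → 𝟙 (does (2 + hubDegree cs (width cs + a) ≟ d)) ≡ 0
    no-hub a rewrite hubDegree-beyond cs (m≤m+n (width cs) a) | dec-false (2 ≟ d) (d≢2 ∘ sym) = refl

1/suc : ℕ → ℚ
1/suc k = mkℚ (ℤ.+ 1) k (1-coprimeTo (suc k))

1/suc-positive : ∀ k → 0ℚ ℚ.< 1/suc k
1/suc-positive k = ℚ.positive⁻¹ (1/suc k)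

ℕtoℚ≡mkℚ : ∀ a → ℕtoℚ a ≡ mkℚ (ℤ.+ a) 0 (coprime-sym (1-coprimeTo a))
ℕtoℚ≡mkℚ a = ℚ.normalize-coprime (coprime-sym (1-coprimeTo a))

1/suc-*-≤ : ∀ k a b → a ≤ suc k * b → 1/suc k ℚ.* ℕtoℚ a ℚ.≤ ℕtoℚ b
1/suc-*-≤ k a b a≤b rewrite ℕtoℚ≡mkℚ a | ℕtoℚ≡mkℚ b =
  ℚ.toℚᵘ-cancel-≤ (ℚᵘ.≤-respˡ-≃ (ℚᵘ.≃-sym (ℚ.toℚᵘ-homo-* (1/suc k) a/1)) unnormalised)
  where
  open ℤ.≤-Reasoning
  a/1 = mkℚ (ℤ.+ a) 0 (coprime-sym (1-coprimeTo a))
  unnormalised : ℚᵘ.mkℚᵘ (ℤ.+ 1) k ℚᵘ.* ℚᵘ.mkℚᵘ (ℤ.+ a) 0 ℚᵘ.≤ ℚᵘ.mkℚᵘ (ℤ.+ b) 0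
  unnormalised = ℚᵘ.*≤* (begin
    (ℤ.+ 1 ℤ.* ℤ.+ a) ℤ.* ℤ.+ 1   ≡⟨ trans (ℤ.*-identityʳ _) (ℤ.*-identityˡ (ℤ.+ a)) ⟩
    ℤ.+ a                     ≤⟨ +≤+ (subst (a ≤_) (*-comm (suc k) b) a≤b) ⟩
    ℤ.+ (b * suc k)           ≡⟨ cong (λ x → ℤ.+ (b * suc x)) (sym (*-identityʳ k)) ⟩
    ℤ.+ (b * suc (k * 1))     ≡⟨ ℤ.pos-* b (suc (k * 1)) ⟩
    ℤ.+ b ℤ.* ℤ.+ suc (k * 1)   ∎)

2+[d∸2]≡d : ∀ {d} → 2 < d → 2 + (d ∸ 2) ≡ d
2+[d∸2]≡d 2<d = m+[n∸m]≡n (<⇒≤ 2<d)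

width-replicate : ∀ k xs → width (concat (replicate k xs)) ≡ k * width xs
width-replicate zero    xs = refl
width-replicate (suc k) xs = trans (width-++ xs _) (cong (width xs +_) (width-replicate k xs))

∈-replicate : ∀ k {xs} {c : ℕ} → c ∈ concat (replicate k xs) → c ∈ xs
∈-replicate (suc k) {xs} c∈ with ∈-++⁻ xs c∈
... | inj₁ c∈xs = c∈xs
... | inj₂ c∈   = ∈-replicate k c∈

degreeCount-replicate : ∀ k xs d → 1 ≤ degreeCount xs d → k ≤ degreeCount (concat (replicate k xs)) d
degreeCount-replicate zero    xs d _   = z≤n
degreeCount-replicate (suc k) xs d 1≤ =
  ≤-trans (+-mono-≤ 1≤ (degreeCount-replicate k xs d 1≤)) (≤-reflexive (sym (degreeCount-++ xs _ d)))

module Realization (ds : List ℕ) (2<ds : All (2 <_) ds) where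

  base : List ℕ
  base = map (_∸ 2) ds

  realizes : ∀ {cs p} (3≤p : 3 ≤ p) → base ⊆ cs → cs ⊆ base →
    Realizes (2 ∷ ds) (BlockGraph.graph cs p 3≤p)
  realizes {cs} {p} 3≤p base⊆cs cs⊆base =
    uniquelyHamiltonian , (λ d → mk⇔ realized degree-of) , (λ _ → 2-connected) ,
    (λ 2∉ → contradiction (here refl) 2∉)
    where
    open BlockGraph cs p 3≤p
    realized : ∀ {d} → d ∈ 2 ∷ ds → ∃ λ v → deg graph v ≡ d
    realized (here refl) = degree-2
    realized (there d∈ds) with v , deg≡ ← degree-hub (base⊆cs (∈-map⁺ (_∸ 2) d∈ds)) =
      v , trans deg≡ (2+[d∸2]≡d (All.lookup 2<ds d∈ds))
    degree-of : ∀ {d} → (∃ λ v → deg graph v ≡ d) → d ∈ 2 ∷ ds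
    degree-of (v , refl) with degree-values v
    ... | inj₁ deg≡2 = here deg≡2
    ... | inj₂ (c , c∈cs , deg≡) with d , d∈ds , refl ← ∈-map⁻ (_∸ 2) (cs⊆base c∈cs) =
      there (subst (_∈ ds) (sym (trans deg≡ (2+[d∸2]≡d (All.lookup 2<ds d∈ds)))) d∈ds)

  uhcRealizable : UhcRealizable (2 ∷ ds)
  uhcRealizable = _ , BlockGraph.graph base 3 ≤-refl , realizes ≤-refl id id

  module Sequence (inD2 : ℕ → Bool) where

    frequent : List ℕ
    frequent = filterᵇ (inD2 ∘ (2 +_)) base

    ∈-frequent⁻ : ∀ {c} → c ∈ frequent → c ∈ base × T (inD2 (2 + c))
    ∈-frequent⁻ = ∈-filter⁻ (T? ∘ inD2 ∘ (2 +_)) {xs = base}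

    repeated : ℕ → List ℕ
    repeated i = concat (replicate (suc i) frequent)

    parameters : ℕ → List ℕ
    parameters i = base ++ repeated i

    -- The padding makes the orders increase strictly even when D₂ is empty.
    padding : ℕ → ℕ
    padding i = suc i * 3

    3≤padding : ∀ i → 3 ≤ padding i
    3≤padding i = m≤m+n 3 (i * 3)

    size : ℕ → ℕ
    size i = width (parameters i) + padding i

    module Graphs (i : ℕ) = BlockGraph (parameters i) (padding i) (3≤padding i)

    graphs : ∀ i → Graph (size i)
    graphs i = Graphs.graph i

    realizes-graphs : ∀ i → Realizes (2 ∷ ds) (graphs i)
    realizes-graphs i = realizes (3≤padding i) ∈-++⁺ˡ parameters⊆base
      where
      parameters⊆base : parameters i ⊆ base
      parameters⊆base c∈ with ∈-++⁻ base c∈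
      ... | inj₁ c∈base = c∈base
      ... | inj₂ c∈rep  = proj₁ (∈-frequent⁻ (∈-replicate (suc i) c∈rep))

    width-parameters : ∀ i → width (parameters i) ≡ width base + suc i * width frequent
    width-parameters i = trans (width-++ base _) (cong (width base +_) (width-replicate (suc i) frequent))

    size-increasing : ∀ i → size i < size (suc i)
    size-increasing i rewrite width-parameters i | width-parameters (suc i) =
      +-mono-≤-< (+-monoʳ-≤ (width base) (*-monoˡ-≤ (width frequent) (n≤1+n (suc i))))
                 (*-monoˡ-< 3 (n<1+n (suc i)))

    scale : ℕ
    scale = 2 + (width base + width frequent)

    size≤ : ∀ i → size i ≤ suc scale * suc i
    size≤ i = begin
      size i
        ≡⟨ cong (_+ padding i) (width-parameters i) ⟩
      width base + suc i * width frequent + suc i * 3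
        ≤⟨ +-monoˡ-≤ _ (+-monoˡ-≤ _ (m≤n*m (width base) (suc i))) ⟩
      suc i * width base + suc i * width frequent + suc i * 3
        ≡⟨ factor (suc i) (width base) (width frequent) ⟩
      suc scale * suc i
        ∎
      where
      open ≤-Reasoning
      factor : ∀ j b f → j * b + j * f + j * 3 ≡ (3 + (b + f)) * j
      factor = solve-∀

    countDeg-rare : ∀ i {d} → d ∈ ds → inD2 d ≡ false → countDeg (graphs i) d ≤ width base
    countDeg-rare i {d} d∈ds rare = begin
      countDeg (graphs i) d                       ≡⟨ Graphs.countDeg-graph i d≢2 ⟩
      degreeCount (parameters i) d                ≡⟨ degreeCount-++ base (repeated i) d ⟩
      degreeCount base d + degreeCount (repeated i) d
        ≡⟨ cong (degreeCount base d +_) (degreeCount-absent (repeated i) d≢2 not-frequent) ⟩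
      degreeCount base d + 0                      ≡⟨ +-identityʳ _ ⟩
      degreeCount base d                          ≤⟨ degreeCount≤width base d ⟩
      width base                                  ∎
      where
      open ≤-Reasoning
      d≢2 : d ≢ 2
      d≢2 = >⇒≢ (All.lookup 2<ds d∈ds)
      not-frequent : ∀ {c} → c ∈ repeated i → 2 + c ≢ d
      not-frequent c∈ refl = contradiction
        (trans (sym rare) (Equivalence.to T-≡ (proj₂ (∈-frequent⁻ (∈-replicate (suc i) c∈)))))
        λ ()

    countDeg-frequent : ∀ i {d} → d ∈ ds → inD2 d ≡ true → suc i ≤ countDeg (graphs i) d
    countDeg-frequent i {d} d∈ds frequent-d = begin
      suc i                                            ≤⟨ degreeCount-replicate (suc i) frequent d present ⟩
      degreeCount (repeated i) d                       ≤⟨ m≤n+m _ (degreeCount base d) ⟩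
      degreeCount base d + degreeCount (repeated i) d  ≡⟨ sym (degreeCount-++ base (repeated i) d) ⟩
      degreeCount (parameters i) d                     ≡⟨ sym (Graphs.countDeg-graph i d≢2) ⟩
      countDeg (graphs i) d                            ∎
      where
      open ≤-Reasoning
      2<d = All.lookup 2<ds d∈ds
      d≢2 : d ≢ 2
      d≢2 = >⇒≢ 2<d
      present : 1 ≤ degreeCount frequent d
      present = subst (λ k → 1 ≤ degreeCount frequent k) (2+[d∸2]≡d 2<d)
        (degreeCount-present frequent (∈-filter⁺ (T? ∘ inD2 ∘ (2 +_)) (∈-map⁺ (_∸ 2) d∈ds)
          (Equivalence.from T-≡ (trans (cong inD2 (2+[d∸2]≡d 2<d)) frequent-d))))

  stronglyUhcRealizable : StronglyUhcRealizable 2 ds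
  stronglyUhcRealizable inD2 =
    width base , 1/suc scale , 1/suc-positive scale , size , graphs , size-increasing , realizes-graphs ,
    (λ i _ d∈ds rare → countDeg-rare i d∈ds rare) ,
    (λ i d d∈ds frequent-d → 1/suc-*-≤ scale (size i) (countDeg (graphs i) d)
       (≤-trans (size≤ i) (*-monoʳ-≤ (suc scale) (countDeg-frequent i d∈ds frequent-d))))
    where open Sequence inD2

mainTheorem1 : (ds : List ℕ) → All (2 <_) ds → Linked _<_ ds →
    UhcRealizable (2 ∷ ds) × (ds ≢ [] → StronglyUhcRealizable 2 ds)
mainTheorem1 ds 2<ds _ = uhcRealizable , λ _ → stronglyUhcRealizable
  where open Realization ds 2<ds
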